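{- Let $P$ be a finite graded connected poset with rank function $\rho$, let $G$ be a group of automorphisms of $P$, and let $\theta$ be the equivalence relation on $P$ whose classes are the $G$-orbits. Then (1) $\rho(p)=\rho(q)$ whenever $p\,\theta\,q$; and (2) the quotient poset $P/G := (P/\theta,\leqslant_\theta)$ is graded.
   Context: A poset $P$ is graded with rank function $\rho\colon P\to\mathbb{Z}_{>0}$ if $p<q$ implies $\rho(p)<\rho(q)$ and whenever $q$ covers $p$ (i.e. $p<q$ with nothing strictly between) we have $\rho(q)=\rho(p)+1$. $P$ is connected if its Hasse diagram (the graph on $P$ with an edge for each covering relation) is connected. $P/\theta$ is the set of classes $[p]$ and $[p]\leqslant_\theta[q]$ iff there exist $p'\in[p]$, $q'\in[q]$ with $p'\leqslant q'$. -}

module Defs where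

open import Data.Nat using (ℕ; suc; _<_)
open import Data.Fin using (Fin)
open import Level using (0ℓ)
open import Data.Product using (Σ; _×_; ∃; ∃-syntax)
open import Relation.Nullary using (¬_)
open import Relation.Binary using (Rel; IsPartialOrder)
open import Relation.Binary.PropositionalEquality using (_≡_)

module _ {A : Set} (_≈_ : Rel A 0ℓ) (_≤_ : Rel A 0ℓ) where

  Strict : A → A → Set
  Strict p q = (p ≤ q) × ¬ (p ≈ q)

  Covers : A → A → Set
  Covers p q = Strict p q × (∀ r → ¬ (Strict p r × Strict r q))

  record IsRankFunction (ρ : A → ℕ) : Set where
    field
      respects : ∀ {p q} → p ≈ q → ρ p ≡ ρ q
      positive : ∀ p → 0 < ρ p
      strictMono : ∀ {p q} → Strict p q → ρ p < ρ q
      coverStep : ∀ {p q} → Covers p q → ρ q ≡ suc (ρ p)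

  Graded : Set
  Graded = Σ (A → ℕ) IsRankFunction

  data HassePath : A → A → Set where
    here : ∀ {p} → HassePath p p
    up   : ∀ {p r q} → Covers p r → HassePath r q → HassePath p q
    down : ∀ {p r q} → Covers r p → HassePath r q → HassePath p q

  Connected : Set
  Connected = ∀ p q → HassePath p q

module _ {n : ℕ} (_≤_ : Rel (Fin n) 0ℓ) where

  IsAutomorphism : (Fin n → Fin n) → Set
  IsAutomorphism g =
    (Σ (Fin n → Fin n) λ h → ((∀ x → h (g x) ≡ x) × (∀ x → g (h x) ≡ x)))
    × (∀ x y → (x ≤ y) → (g x ≤ g y))
    × (∀ x y → (g x ≤ g y) → (x ≤ y))

  record IsAutGroup (G : (Fin n → Fin n) → Set) : Set where
    field
      auto : ∀ g → G g → IsAutomorphism g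
      hasId : G (λ x → x)
      closedComp : ∀ g h → G g → G h → G (λ x → g (h x))
      closedInv : ∀ g → G g →
        Σ (Fin n → Fin n) λ h → (G h × (∀ x → h (g x) ≡ x) × (∀ x → g (h x) ≡ x))

module _ {n : ℕ} (G : (Fin n → Fin n) → Set) where

  Orbit : Rel (Fin n) 0ℓ
  Orbit p q = Σ (Fin n → Fin n) λ g → (G g × (g p ≡ q))

module _ {n : ℕ} (_≈_ : Rel (Fin n) 0ℓ) (_≤_ : Rel (Fin n) 0ℓ) where

  -- [p] ≤_θ [q] iff ∃ p' ∈ [p], q' ∈ [q], p' ≤ q'   (on representatives)
  QuotLe : Rel (Fin n) 0ℓ
  QuotLe p q = Σ (Fin n) λ p′ → Σ (Fin n) λ q′ → ((p ≈ p′) × (q ≈ q′) × (p′ ≤ q′))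

-- An automorphism g maps covers to covers, so along any Hasse path the shift
-- ρ (g x) − ρ x stays constant; by connectedness it is one number for all of P.
-- At an element m of minimal rank, ρ m + ρ m = ρ (g m) + ρ (g⁻¹ m) with both
-- summands at least ρ m, so the shift is 0 and ranks are constant on orbits.
-- Since orbits are rank-homogeneous and G acts by order automorphisms, a strict
-- relation or a cover [p] < [q] in P/G is witnessed by a strict relation or a
-- cover p′ < q′ of representatives, so ρ descends to a rank function on P/G.
module Submission where

open import Defs
open import Data.Nat using (ℕ; suc; _+_; _<_) renaming (_≤_ to _≤ℕ_)
open import Data.Nat.Properties
  using (≤-totalOrder; +-suc; +-comm; +-cancelˡ-≡; +-cancelʳ-≤; +-monoʳ-≤;
         suc-injective; ≤-antisym; ≤-refl; ≤-reflexive; ≤-trans; <⇒≤; <-irrefl)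
open import Data.Fin using (Fin; _≟_)
open import Data.List using (allFin)
open import Data.List.Extrema ≤-totalOrder using (argmin; f[argmin]≤f[xs])
open import Data.List.Membership.Propositional.Properties using (∈-allFin)
import Data.List.Relation.Unary.All as All
open import Level using (0ℓ)
open import Data.Product using (_×_; _,_; Σ; ∃-syntax; proj₁; proj₂)
open import Data.Empty using (⊥; ⊥-elim)
open import Relation.Nullary using (yes; no)
open import Relation.Binary using (Rel; IsPartialOrder; IsEquivalence)
open import Relation.Binary.PropositionalEquality
  using (_≡_; refl; sym; trans; cong; subst; subst₂; module ≡-Reasoning)

m+m≡n+o⇒n≡m : ∀ {m n o} → m + m ≡ n + o → m ≤ℕ n → m ≤ℕ o → n ≡ m
m+m≡n+o⇒n≡m {m} {n} {o} eq m≤n m≤o = ≤-antisym n≤m m≤n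
  where
  n≤m : n ≤ℕ m
  n≤m = +-cancelʳ-≤ o n m (≤-trans (≤-reflexive (sym eq)) (+-monoʳ-≤ m m≤o))

rank-minimiser : ∀ {n} (f : Fin n → ℕ) → Fin n → Σ (Fin n) λ m → ∀ q → f m ≤ℕ f q
rank-minimiser {n} f p =
  argmin f p (allFin n) , λ q → All.lookup (f[argmin]≤f[xs] p (allFin n)) (∈-allFin q)

module _ {A : Set} {_≤_ : Rel A 0ℓ} {g h : A → A}
  (h∘g : ∀ x → h (g x) ≡ x) (g∘h : ∀ x → g (h x) ≡ x)
  (g-mono : ∀ x y → x ≤ y → g x ≤ g y) (g-reflect : ∀ x y → g x ≤ g y → x ≤ y) where

  Strict-preserved : ∀ {p q} → Strict _≡_ _≤_ p q → Strict _≡_ _≤_ (g p) (g q)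
  Strict-preserved {p} {q} (p≤q , p≢q) =
    g-mono p q p≤q , λ gp≡gq → p≢q (subst₂ _≡_ (h∘g p) (h∘g q) (cong h gp≡gq))

  Strict-reflected : ∀ {p q} → Strict _≡_ _≤_ (g p) (g q) → Strict _≡_ _≤_ p q
  Strict-reflected {p} {q} (gp≤gq , gp≢gq) = g-reflect p q gp≤gq , λ p≡q → gp≢gq (cong g p≡q)

  Covers-preserved : ∀ {p q} → Covers _≡_ _≤_ p q → Covers _≡_ _≤_ (g p) (g q)
  Covers-preserved {p} {q} (p<q , nothing-between) = Strict-preserved p<q , between-reflected
    where
    between-reflected : ∀ r → Strict _≡_ _≤_ (g p) r × Strict _≡_ _≤_ r (g q) → ⊥
    between-reflected r (gp<r , r<gq) = nothing-between (h r)
      ( Strict-reflected (subst (Strict _≡_ _≤_ (g p)) (sym (g∘h r)) gp<r)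
      , Strict-reflected (subst (λ s → Strict _≡_ _≤_ s (g q)) (sym (g∘h r)) r<gq))

module _ {A : Set} {_≤_ : Rel A 0ℓ} {ρ : A → ℕ} (rank : IsRankFunction _≡_ _≤_ ρ)
  {g : A → A} (g-covers : ∀ {p q} → Covers _≡_ _≤_ p q → Covers _≡_ _≤_ (g p) (g q)) where

  open IsRankFunction rank
  open ≡-Reasoning

  -- The shift ρ (g x) − ρ x, written without truncated subtraction.
  rank-shift-along-path : ∀ {x y} → HassePath _≡_ _≤_ x y → ρ (g x) + ρ y ≡ ρ (g y) + ρ x
  rank-shift-along-path here = refl
  rank-shift-along-path {x} {y} (up {r = r} x⋖r r⇝y) = suc-injective (begin
    suc (ρ (g x) + ρ y)  ≡⟨ cong (_+ ρ y) (sym (coverStep (g-covers x⋖r))) ⟩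
    ρ (g r) + ρ y        ≡⟨ rank-shift-along-path r⇝y ⟩
    ρ (g y) + ρ r        ≡⟨ cong (ρ (g y) +_) (coverStep x⋖r) ⟩
    ρ (g y) + suc (ρ x)  ≡⟨ +-suc (ρ (g y)) (ρ x) ⟩
    suc (ρ (g y) + ρ x)  ∎)
  rank-shift-along-path {x} {y} (down {r = r} r⋖x r⇝y) = begin
    ρ (g x) + ρ y        ≡⟨ cong (_+ ρ y) (coverStep (g-covers r⋖x)) ⟩
    suc (ρ (g r) + ρ y)  ≡⟨ cong suc (rank-shift-along-path r⇝y) ⟩
    suc (ρ (g y) + ρ r)  ≡⟨ sym (+-suc (ρ (g y)) (ρ r)) ⟩
    ρ (g y) + suc (ρ r)  ≡⟨ cong (ρ (g y) +_) (sym (coverStep r⋖x)) ⟩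
    ρ (g y) + ρ x        ∎

  rank-invariant : Connected _≡_ _≤_ → ∀ {m m′} → g m′ ≡ m → (∀ q → ρ m ≤ℕ ρ q) →
                   ∀ p → ρ (g p) ≡ ρ p
  rank-invariant connected {m} {m′} gm′≡m m-minimal p =
    +-cancelˡ-≡ (ρ m) (ρ (g p)) (ρ p) (begin
      ρ m + ρ (g p)  ≡⟨ +-comm (ρ m) (ρ (g p)) ⟩
      ρ (g p) + ρ m  ≡⟨ rank-shift-along-path (connected p m) ⟩
      ρ (g m) + ρ p  ≡⟨ cong (_+ ρ p) gm≡m ⟩
      ρ m + ρ p      ∎)
    where
    gm≡m : ρ (g m) ≡ ρ m
    gm≡m = m+m≡n+o⇒n≡m
      (subst (λ s → ρ s + ρ m ≡ ρ (g m) + ρ m′) gm′≡m (rank-shift-along-path (connected m′ m)))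
      (m-minimal (g m)) (m-minimal m′)

module _ {n : ℕ} {_≤_ : Rel (Fin n) 0ℓ} {G : (Fin n → Fin n) → Set}
  (autGroup : IsAutGroup _≤_ G) where

  open IsAutGroup autGroup

  Orbit-isEquivalence : IsEquivalence (Orbit G)
  Orbit-isEquivalence = record
    { refl  = (λ x → x) , hasId , refl
    ; sym   = Orbit-sym
    ; trans = λ { (g , Gg , gp≡q) (f , Gf , fq≡r) →
                  (λ x → f (g x)) , closedComp f g Gf Gg , trans (cong f gp≡q) fq≡r }
    }
    where
    Orbit-sym : ∀ {p q} → Orbit G p q → Orbit G q p
    Orbit-sym {p} (g , Gg , gp≡q) with closedInv g Gg
    ... | h , Gh , h∘g , _ = h , Gh , trans (cong h (sym gp≡q)) (h∘g p)

  Orbit-lift : ∀ {p q q′} → p ≤ q → Orbit G q q′ → ∃[ p′ ] Orbit G p p′ × p′ ≤ q′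
  Orbit-lift {p} {q} p≤q (g , Gg , gq≡q′) =
    g p , (g , Gg , refl) , subst (g p ≤_) gq≡q′ (proj₁ (proj₂ (auto g Gg)) p q p≤q)

  Orbit-preserves-rank : ∀ {ρ} → IsRankFunction _≡_ _≤_ ρ → Connected _≡_ _≤_ →
                         ∀ p q → Orbit G p q → ρ p ≡ ρ q
  Orbit-preserves-rank {ρ} rank connected p q (g , Gg , gp≡q)
    with auto g Gg | rank-minimiser ρ p
  ... | ((h , h∘g , g∘h) , g-mono , g-reflect) | m , m-minimal =
    trans (sym (rank-invariant rank (Covers-preserved h∘g g∘h g-mono g-reflect)
                  connected (g∘h m) m-minimal p))
          (cong ρ gp≡q)

module Quotient {n : ℕ} {_≤_ : Rel (Fin n) 0ℓ} (po : IsPartialOrder _≡_ _≤_)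
  {ρ : Fin n → ℕ} (rank : IsRankFunction _≡_ _≤_ ρ)
  {_θ_ : Rel (Fin n) 0ℓ} (θ-equiv : IsEquivalence _θ_)
  (ρ-respects-θ : ∀ {p q} → p θ q → ρ p ≡ ρ q)
  (θ-lift : ∀ {p q q′} → p ≤ q → q θ q′ → ∃[ p′ ] p θ p′ × p′ ≤ q′) where

  open IsRankFunction rank
  module θ = IsEquivalence θ-equiv
  module P = IsPartialOrder po

  _≤θ_ : Rel (Fin n) 0ℓ
  _≤θ_ = QuotLe _θ_ _≤_

  rank-mono : ∀ {x y} → x ≤ y → ρ x ≤ℕ ρ y
  rank-mono {x} {y} x≤y with x ≟ y
  ... | yes refl = ≤-refl
  ... | no x≢y   = <⇒≤ (strictMono (x≤y , x≢y))

  ≤θ-rank-mono : ∀ {p q} → p ≤θ q → ρ p ≤ℕ ρ q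
  ≤θ-rank-mono (p′ , q′ , pθp′ , qθq′ , p′≤q′) =
    subst₂ _≤ℕ_ (sym (ρ-respects-θ pθp′)) (sym (ρ-respects-θ qθq′)) (rank-mono p′≤q′)

  ≤θ-trans : ∀ {p q r} → p ≤θ q → q ≤θ r → p ≤θ r
  ≤θ-trans (p′ , q′ , pθp′ , qθq′ , p′≤q′) (q″ , r′ , qθq″ , rθr′ , q″≤r′)
    with θ-lift p′≤q′ (θ.trans (θ.sym qθq′) qθq″)
  ... | p″ , p′θp″ , p″≤q″ = p″ , r′ , θ.trans pθp′ p′θp″ , rθr′ , P.trans p″≤q″ q″≤r′

  ≤θ-antisym : ∀ {p q} → p ≤θ q → q ≤θ p → p θ q
  ≤θ-antisym p≤θq@(p′ , q′ , pθp′ , qθq′ , p′≤q′) q≤θp with p′ ≟ q′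
  ... | yes refl = θ.trans pθp′ (θ.sym qθq′)
  ... | no p′≢q′ = ⊥-elim (<-irrefl ρp′≡ρq′ (strictMono (p′≤q′ , p′≢q′)))
    where
    ρp′≡ρq′ : ρ p′ ≡ ρ q′
    ρp′≡ρq′ = trans (sym (ρ-respects-θ pθp′))
                (trans (≤-antisym (≤θ-rank-mono p≤θq) (≤θ-rank-mono q≤θp)) (ρ-respects-θ qθq′))

  ≤θ-isPartialOrder : IsPartialOrder _θ_ _≤θ_
  ≤θ-isPartialOrder = record
    { isPreorder = record
      { isEquivalence = θ-equiv
      ; reflexive     = λ {p} pθq → p , p , θ.refl , θ.sym pθq , P.refl
      ; trans         = ≤θ-trans
      }
    ; antisym = ≤θ-antisym
    }

  strict-representatives : ∀ {p q} → Strict _θ_ _≤θ_ p q →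
    ∃[ p′ ] ∃[ q′ ] p θ p′ × q θ q′ × Strict _≡_ _≤_ p′ q′
  strict-representatives ((p′ , q′ , pθp′ , qθq′ , p′≤q′) , ¬pθq) =
    p′ , q′ , pθp′ , qθq′ , p′≤q′ ,
    λ { refl → ¬pθq (θ.trans pθp′ (θ.sym qθq′)) }

  ≤θ-strictMono : ∀ {p q} → Strict _θ_ _≤θ_ p q → ρ p < ρ q
  ≤θ-strictMono p<θq with strict-representatives p<θq
  ... | p′ , q′ , pθp′ , qθq′ , p′<q′ =
    subst₂ _<_ (sym (ρ-respects-θ pθp′)) (sym (ρ-respects-θ qθq′)) (strictMono p′<q′)

  -- An element strictly between representatives would lie strictly between the
  -- classes, since ranks separate it from both.
  ≤θ-coverStep : ∀ {p q} → Covers _θ_ _≤θ_ p q → ρ q ≡ suc (ρ p)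
  ≤θ-coverStep (p<θq , nothing-between) with strict-representatives p<θq
  ... | p′ , q′ , pθp′ , qθq′ , p′<q′ =
    trans (ρ-respects-θ qθq′) (trans (coverStep p′⋖q′) (cong suc (sym (ρ-respects-θ pθp′))))
    where
    p′⋖q′ : Covers _≡_ _≤_ p′ q′
    p′⋖q′ = p′<q′ , λ r (p′<r , r<q′) → nothing-between r
      ( ((p′ , r , pθp′ , θ.refl , proj₁ p′<r) ,
         λ pθr → <-irrefl (trans (sym (ρ-respects-θ pθp′)) (ρ-respects-θ pθr)) (strictMono p′<r))
      , ((r , q′ , θ.refl , qθq′ , proj₁ r<q′) ,
         λ rθq → <-irrefl (trans (ρ-respects-θ rθq) (ρ-respects-θ qθq′)) (strictMono r<q′)))

  ≤θ-graded : Graded _θ_ _≤θ_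
  ≤θ-graded = ρ , record
    { respects   = ρ-respects-θ
    ; positive   = positive
    ; strictMono = ≤θ-strictMono
    ; coverStep  = ≤θ-coverStep
    }

proposition6p15 : (n : ℕ) (_≤_ : Rel (Fin n) 0ℓ) → IsPartialOrder _≡_ _≤_ →
    (ρ : Fin n → ℕ) → IsRankFunction _≡_ _≤_ ρ → Connected _≡_ _≤_ →
    (G : (Fin n → Fin n) → Set) → IsAutGroup _≤_ G →
    ((∀ p q → Orbit G p q → ρ p ≡ ρ q)
    × (IsPartialOrder (Orbit G) (QuotLe (Orbit G) _≤_)
    × Graded (Orbit G) (QuotLe (Orbit G) _≤_)))
proposition6p15 n _≤_ po ρ rank connected G autGroup =
  orbits-rank-homogeneous , ≤θ-isPartialOrder , ≤θ-graded
  where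
  orbits-rank-homogeneous : ∀ p q → Orbit G p q → ρ p ≡ ρ q
  orbits-rank-homogeneous = Orbit-preserves-rank autGroup rank connected
  open Quotient po rank (Orbit-isEquivalence autGroup)
    (orbits-rank-homogeneous _ _) (Orbit-lift autGroup)
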